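{- Let $n\ge 1$ and let $\sigma$ be an edge 2-coloring of the complete graph $K_n$. Suppose a color $c$ used by $\sigma$ satisfies $V(K_n^c)\subsetneq V(K_n)$ and there is exactly one color $F\ne c$ with $V(K_n^c)\cap V(K_n^F)\neq\emptyset$. Then every vertex of $K_n$ is incident to an edge of color $F$.
   Context: An edge 2-coloring of a graph is an assignment of colors to its edges such that each vertex is incident to edges of at most 2 distinct colors. For a color $c$, the color subgraph $K_n^c$ is the subgraph of $K_n$ induced by the edges of color $c$; its vertex set $V(K_n^c)$ consists of the vertices incident to at least one edge of color $c$. -}

module Defs where

open import Data.Nat using (ℕ)
open import Data.Fin using (Fin)
open import Data.Product using (Σ; ∃; _×_)
open import Data.Sum using (_⊎_)
open import Relation.Binary.PropositionalEquality using (_≡_; _≢_)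

-- An edge colouring of the complete graph K_n with colours from C:
-- a symmetric function on pairs of vertices; only its values on pairs
-- of distinct vertices (the edges of K_n) are meaningful.
record EdgeColouring (n : ℕ) (C : Set) : Set where
  field
    col : Fin n → Fin n → C
    sym : ∀ u v → col u v ≡ col v u
open EdgeColouring public

InColour : ∀ {n C} → EdgeColouring n C → C → Fin n → Set
InColour σ c v = ∃ λ u → (u ≢ v) × (col σ v u ≡ c)

Is2Colouring : ∀ {n C} → EdgeColouring n C → Set
Is2Colouring {n} {C} σ =
  ∀ (v : Fin n) → Σ C λ c₁ → Σ C λ c₂ →
    ∀ (u : Fin n) → u ≢ v → (col σ v u ≡ c₁) ⊎ (col σ v u ≡ c₂)

Used : ∀ {n C} → EdgeColouring n C → C → Set
Used {n} σ c = Σ (Fin n) λ u → Σ (Fin n) λ v → (u ≢ v) × (col σ u v ≡ c)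

Meet : ∀ {n C} → EdgeColouring n C → C → C → Set
Meet {n} σ c F = Σ (Fin n) λ v → InColour σ c v × InColour σ F v

-- Take an edge ab of colour c and a vertex w outside V(K_n^c). The edge aw is
-- not of colour c, and it meets V(K_n^c) at a, so by uniqueness it has colour F.
-- Hence a sees exactly the two colours c and F. Any other vertex v is joined to a
-- by an edge of colour F (done), or of colour c; then v ∈ V(K_n^c), so again the
-- edge vw is not of colour c and must have colour F.
module Submission where

open import Defs
open import Data.Nat using (ℕ; _≤_)
open import Data.Fin using (Fin; _≟_)
open import Data.Product using (Σ; _,_)
open import Data.Sum using (_⊎_; inj₁; inj₂)
open import Relation.Nullary using (¬_; yes; no; contradiction)
open import Relation.Binary.PropositionalEquality
  using (_≡_; _≢_; refl; trans; ≢-sym) renaming (sym to ≡-sym)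

third-of-two : {A : Set} {x y p q r : A} →
  p ≡ x ⊎ p ≡ y → q ≡ x ⊎ q ≡ y → r ≡ x ⊎ r ≡ y → p ≢ q → r ≡ p ⊎ r ≡ q
third-of-two (inj₁ p≡x) _          (inj₁ r≡x) _   = inj₁ (trans r≡x (≡-sym p≡x))
third-of-two (inj₂ p≡y) _          (inj₂ r≡y) _   = inj₁ (trans r≡y (≡-sym p≡y))
third-of-two _          (inj₁ q≡x) (inj₁ r≡x) _   = inj₂ (trans r≡x (≡-sym q≡x))
third-of-two _          (inj₂ q≡y) (inj₂ r≡y) _   = inj₂ (trans r≡y (≡-sym q≡y))
third-of-two (inj₁ p≡x) (inj₁ q≡x) (inj₂ _)   p≢q = contradiction (trans p≡x (≡-sym q≡x)) p≢q
third-of-two (inj₂ p≡y) (inj₂ q≡y) (inj₁ _)   p≢q = contradiction (trans p≡y (≡-sym q≡y)) p≢q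

module _ {n : ℕ} {C : Set} (σ : EdgeColouring n C) where

  InColour-via : ∀ {c u v} → u ≢ v → col σ u v ≡ c → InColour σ c v
  InColour-via {u = u} {v} u≢v uv≡c = u , u≢v , trans (EdgeColouring.sym σ v u) uv≡c

  outside≢inside : ∀ {c u w} → ¬ InColour σ c w → InColour σ c u → w ≢ u
  outside≢inside w∉c u∈c refl = w∉c u∈c

  col≢-outside : ∀ {c u w} → ¬ InColour σ c w → u ≢ w → col σ u w ≢ c
  col≢-outside w∉c u≢w uw≡c = w∉c (InColour-via u≢w uw≡c)

  col-between-two-colours : Is2Colouring σ → ∀ {a u₁ u₂} u →
    u₁ ≢ a → u₂ ≢ a → u ≢ a → col σ a u₁ ≢ col σ a u₂ →
    col σ a u ≡ col σ a u₁ ⊎ col σ a u ≡ col σ a u₂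
  col-between-two-colours two {a} u u₁≢a u₂≢a u≢a distinct with two a
  ... | _ , _ , at-a = third-of-two (at-a _ u₁≢a) (at-a _ u₂≢a) (at-a u u≢a) distinct

  module UniqueNeighbourColour {c F : C}
    (uniq : ∀ F′ → F′ ≢ c → Meet σ c F′ → F′ ≡ F) where

    col≡unique : ∀ {x y} → InColour σ c x → y ≢ x → col σ x y ≢ c → col σ x y ≡ F
    col≡unique {x} {y} x∈c y≢x ≢c = uniq (col σ x y) ≢c (x , x∈c , y , y≢x , refl)

    col-to-outside≡unique : ∀ {x w} → InColour σ c x → ¬ InColour σ c w → col σ x w ≡ F
    col-to-outside≡unique {x} {w} x∈c w∉c = col≡unique x∈c w≢x (col≢-outside w∉c (≢-sym w≢x))
      where
      w≢x : w ≢ x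
      w≢x = outside≢inside w∉c x∈c

lemma4 : (n : ℕ) → 1 ≤ n → (C : Set) → (σ : EdgeColouring n C) → Is2Colouring σ →
    (c : C) → Used σ c →
    Σ (Fin n) (λ w → ¬ InColour σ c w) →
    (F : C) → F ≢ c → Meet σ c F →
    (∀ (F′ : C) → F′ ≢ c → Meet σ c F′ → F′ ≡ F) →
    ∀ (v : Fin n) → InColour σ F v
lemma4 n _ C σ two c (a , b , a≢b , ab≡c) (w , w∉c) F F≢c _ uniq = in-F
  where
  open UniqueNeighbourColour σ uniq

  a∈c : InColour σ c a
  a∈c = b , ≢-sym a≢b , ab≡c

  w≢a : w ≢ a
  w≢a = outside≢inside σ w∉c a∈c

  aw≡F : col σ a w ≡ F
  aw≡F = col-to-outside≡unique a∈c w∉c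

  in-F : ∀ v → InColour σ F v
  in-F v with v ≟ a
  ... | yes refl = w , w≢a , aw≡F
  ... | no v≢a
    with col-between-two-colours σ two v (≢-sym a≢b) w≢a v≢a
           (λ ab≡aw → F≢c (trans (≡-sym aw≡F) (trans (≡-sym ab≡aw) ab≡c)))
  ...   | inj₁ av≡ab = w , outside≢inside σ w∉c v∈c , col-to-outside≡unique v∈c w∉c
    where
    v∈c : InColour σ c v
    v∈c = InColour-via σ (≢-sym v≢a) (trans av≡ab ab≡c)
  ...   | inj₂ av≡aw = InColour-via σ (≢-sym v≢a) (trans av≡aw aw≡F)
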